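{- Let $H$ be a graph of girth at least $6$, let $xy\in E_H$, and let $G=H^2$. Let $C_{xy}=N_G(x)\cap N_G(y)$. Then $G[C_{xy}]$ has at most two connected components. Moreover, if $A$ and $B$ are disjoint vertex sets such that the connected components of $G[C_{xy}]$ are exactly the nonempty ones among $G[A]$ and $G[B]$ (so one of $A,B$ may be empty), then either (i) $A=N_H(x)\setminus\{y\}$ and $B=N_H(y)\setminus\{x\}$, or (ii) $B=N_H(x)\setminus\{y\}$ and $A=N_H(y)\setminus\{x\}$.
   Context: All graphs are finite, undirected and simple. For a graph $H$, $H^2$ is the graph on the same vertex set in which two distinct vertices are adjacent iff their distance in $H$ is at most $2$. The girth of a graph is the length of a shortest cycle ($\infty$ if acyclic). $N_G(v)$ is the neighbourhood of $v$ in $G$ and $G[X]$ is the subgraph of $G$ induced by $X$. -}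

module Defs where

open import Data.Nat using (ℕ; zero; suc; _≤_)
open import Data.Fin using (Fin; zero; suc; inject₁; fromℕ)
open import Data.Fin.Subset using (Subset; _∈_; _⊆_; _-_; Nonempty)
open import Data.Bool using (Bool; true; false)
open import Data.Product using (Σ; ∃; _×_; _,_)
open import Data.Sum using (_⊎_)
open import Data.Vec using (tabulate)
open import Function.Definitions using (Injective)
open import Relation.Binary.PropositionalEquality using (_≡_; _≢_)

record Graph (n : ℕ) : Set where
  field
    E     : Fin n → Fin n → Bool
    E-sym : ∀ u v → E u v ≡ E v u
    E-irr : ∀ v → E v v ≡ false

open Graph public

Adj : ∀ {n} → Graph n → Fin n → Fin n → Set
Adj H u v = E H u v ≡ true

N : ∀ {n} → Graph n → Fin n → Subset n
N H v = tabulate (E H v)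

-- A cycle of length (suc m), m ≥ 2: distinct vertices f 0, …, f m with
-- f i ~ f (i+1) for i < m and f m ~ f 0.
IsCycle : ∀ {n} → Graph n → (m : ℕ) → (Fin (suc m) → Fin n) → Set
IsCycle H m f =
  (2 ≤ m)
  × Injective _≡_ _≡_ f
  × (∀ (i : Fin m) → Adj H (f (inject₁ i)) (f (suc i)))
  × Adj H (f (fromℕ m)) (f zero)

GirthAtLeast : ∀ {n} → ℕ → Graph n → Set
GirthAtLeast g H = ∀ m f → IsCycle H m f → g ≤ suc m

Adj² : ∀ {n} → Graph n → Fin n → Fin n → Set
Adj² H u v = u ≢ v × (Adj H u v ⊎ ∃ λ w → Adj H u w × Adj H w v)

C : ∀ {n} → Graph n → Fin n → Fin n → Fin n → Set
C H x y v = Adj² H x v × Adj² H y v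

data Reach {n} (R : Fin n → Fin n → Set) (X : Subset n) : Fin n → Fin n → Set where
  here : ∀ {u} → Reach R X u u
  step : ∀ {u w v} → R u w → w ∈ X → Reach R X w v → Reach R X u v

Connected : ∀ {n} → (Fin n → Fin n → Set) → Subset n → Set
Connected R X = ∀ u v → u ∈ X → v ∈ X → Reach R X u v

IsComponent : ∀ {n} → (Fin n → Fin n → Set) → (Fin n → Set) → Subset n → Set
IsComponent R S X =
  Nonempty X
  × (∀ v → v ∈ X → S v)
  × Connected R X
  × (∀ Y → X ⊆ Y → (∀ v → v ∈ Y → S v) → Connected R Y → Y ≡ X)

-- Since H has girth at least 6, a vertex at distance at most 2 from both ends of
-- the edge xy is a neighbour of x or of y (otherwise H would contain a closed
-- walk of length 5), so C_xy = (N(x) - y) ∪ (N(y) - x). Each of these two sets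
-- is a clique of H², and no edge of H² joins them (it would close a cycle of
-- length 4 or 5 through xy). Hence the components of H²[C_xy] are exactly the
-- nonempty ones among N(x) - y and N(y) - x.
module Submission where

open import Defs
open import Data.Fin using (Fin)
open import Data.Fin.Subset using (Subset; _∈_; _∉_; _-_; Nonempty)
open import Data.Product using (_×_)
open import Data.Sum using (_⊎_)
open import Relation.Binary.PropositionalEquality using (_≡_)

open import Data.Empty using (⊥; ⊥-elim)
open import Data.Fin using (zero; suc; inject₁; fromℕ)
open import Data.Fin.Properties using (_≟_)
open import Data.Fin.Subset using (_─_; _⊆_; Empty; outside)
open import Data.Fin.Subset.Properties
  using (⊆-antisym; nonempty?; p─q⊆p; x∈p∧x∉q⇒x∈p─q; x≢y⇒x∉⁅y⁆; x∉⁅y⁆⇒x≢y)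
open import Data.Nat using (suc; _≤_; s≤s; z≤n)
open import Data.Nat.Properties using (≤-trans; <-irrefl; n≤1+n; m≤n+m)
open import Data.Product using (_,_; proj₁; proj₂; swap)
open import Data.Sum using (inj₁; inj₂)
import Data.Sum as Sum
open import Data.Vec using (Vec; []; _∷_; here; there; lookup)
open import Data.Vec.Properties using (lookup∘tabulate; []=⇒lookup; lookup⇒[]=)
open import Data.Vec.Relation.Unary.All using ([]; _∷_)
open import Data.Vec.Relation.Unary.AllPairs using ([]; _∷_)
open import Data.Vec.Relation.Unary.Unique.Propositional using (Unique)
open import Data.Vec.Relation.Unary.Unique.Propositional.Properties using (lookup-injective)
open import Relation.Nullary using (¬_; yes; no)
open import Relation.Binary.PropositionalEquality
  using (_≢_; refl; sym; trans; ≢-sym)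

x∈p─q⇒x∉q : ∀ {n} {p q : Subset n} {x} → x ∈ p ─ q → x ∉ q
x∈p─q⇒x∉q {p = _ ∷ _} {outside ∷ _} here ()
x∈p─q⇒x∉q {p = _ ∷ _} {_ ∷ _} (there x∈p─q) (there x∈q) = x∈p─q⇒x∉q x∈p─q x∈q

Empty⇒≡ : ∀ {n} {p q : Subset n} → Empty p → Empty q → p ≡ q
Empty⇒≡ ∅p ∅q =
  ⊆-antisym (λ {x} x∈p → ⊥-elim (∅p (x , x∈p))) (λ {x} x∈q → ⊥-elim (∅q (x , x∈q)))

Disjoint : ∀ {n} → Subset n → Subset n → Set
Disjoint p q = ∀ v → v ∈ p → v ∉ q

Disjoint-sym : ∀ {n} {p q : Subset n} → Disjoint p q → Disjoint q p
Disjoint-sym p∩q≡∅ v v∈q v∈p = p∩q≡∅ v v∈p v∈q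

Nonempty⇒≢ : ∀ {n} {p q : Subset n} → Nonempty p → Disjoint p q → p ≢ q
Nonempty⇒≢ (v , v∈p) p∩q≡∅ refl = p∩q≡∅ v v∈p v∈p

≡-two-of-three : ∀ {a} {A : Set a} {p q x y z : A} →
  x ≡ p ⊎ x ≡ q → y ≡ p ⊎ y ≡ q → z ≡ p ⊎ z ≡ q → x ≡ y ⊎ x ≡ z ⊎ y ≡ z
≡-two-of-three (inj₁ refl) (inj₁ refl) _           = inj₁ refl
≡-two-of-three (inj₂ refl) (inj₂ refl) _           = inj₁ refl
≡-two-of-three (inj₁ refl) (inj₂ refl) (inj₁ refl) = inj₂ (inj₁ refl)
≡-two-of-three (inj₂ refl) (inj₁ refl) (inj₂ refl) = inj₂ (inj₁ refl)
≡-two-of-three (inj₁ refl) (inj₂ refl) (inj₂ refl) = inj₂ (inj₂ refl)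
≡-two-of-three (inj₂ refl) (inj₁ refl) (inj₁ refl) = inj₂ (inj₂ refl)

module SameNonemptyMembers {n} {A B K L : Subset n} (A∩B≡∅ : Disjoint A B) (K∩L≡∅ : Disjoint K L)
  (AB⇒KL : ∀ X → Nonempty X → X ≡ A ⊎ X ≡ B → X ≡ K ⊎ X ≡ L)
  (KL⇒AB : ∀ X → Nonempty X → X ≡ K ⊎ X ≡ L → X ≡ A ⊎ X ≡ B) where

  private
    ≢-Empty : ∀ {X Y : Subset n} → Nonempty X → Empty Y → X ≢ Y
    ≢-Empty neX ∅Y refl = ∅Y neX

  first-matched : A ≡ K ⊎ A ≡ L
  first-matched with nonempty? A | nonempty? K | nonempty? L
  ... | yes neA | _       | _       = AB⇒KL A neA (inj₁ refl)
  ... | no ∅A   | no ∅K   | _       = inj₁ (Empty⇒≡ ∅A ∅K)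
  ... | no ∅A   | yes _   | no ∅L   = inj₂ (Empty⇒≡ ∅A ∅L)
  ... | no ∅A   | yes neK | yes neL =
    ⊥-elim (Nonempty⇒≢ neK K∩L≡∅
      (trans (only-B neK (inj₁ refl)) (sym (only-B neL (inj₂ refl)))))
    where
    only-B : ∀ {X} → Nonempty X → X ≡ K ⊎ X ≡ L → X ≡ B
    only-B {X} neX X∈KL =
      Sum.[ (λ X≡A → ⊥-elim (≢-Empty neX ∅A X≡A)) , (λ X≡B → X≡B) ] (KL⇒AB X neX X∈KL)

  second-matched : A ≡ K → B ≡ L
  second-matched refl with nonempty? B | nonempty? L
  ... | yes neB | _ =
    Sum.[ (λ B≡A → ⊥-elim (Nonempty⇒≢ neB (Disjoint-sym A∩B≡∅) B≡A)) , (λ B≡L → B≡L) ]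
      (AB⇒KL B neB (inj₂ refl))
  ... | no ∅B | yes neL =
    Sum.[ (λ L≡A → ⊥-elim (Nonempty⇒≢ neL (Disjoint-sym K∩L≡∅) L≡A))
        , (λ L≡B → ⊥-elim (≢-Empty neL ∅B L≡B)) ]
      (KL⇒AB L neL (inj₂ refl))
  ... | no ∅B | no ∅L = Empty⇒≡ ∅B ∅L

same-nonempty-members⇒≡ : ∀ {n} {A B K L : Subset n} → Disjoint A B → Disjoint K L →
  (∀ X → Nonempty X → X ≡ A ⊎ X ≡ B → X ≡ K ⊎ X ≡ L) →
  (∀ X → Nonempty X → X ≡ K ⊎ X ≡ L → X ≡ A ⊎ X ≡ B) →
  (A ≡ K × B ≡ L) ⊎ (B ≡ K × A ≡ L)
same-nonempty-members⇒≡ A∩B≡∅ K∩L≡∅ AB⇒KL KL⇒AB =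
  Sum.map (λ A≡K → A≡K , second-matched A≡K) (λ A≡L → swapped.second-matched A≡L , A≡L)
    first-matched
  where
  open SameNonemptyMembers A∩B≡∅ K∩L≡∅ AB⇒KL KL⇒AB
  module swapped = SameNonemptyMembers A∩B≡∅ (Disjoint-sym K∩L≡∅)
    (λ X neX X∈AB → Sum.swap (AB⇒KL X neX X∈AB)) (λ X neX X∈LK → KL⇒AB X neX (Sum.swap X∈LK))

record SeparatedPart {n} (R : Fin n → Fin n → Set) (S : Fin n → Set) (K L : Subset n) : Set where
  field
    part⊆S    : ∀ v → v ∈ K → S v
    connected : Connected R K
    covers    : ∀ v → S v → v ∈ K ⊎ v ∈ L
    no-edge   : ∀ {u w} → u ∈ K → w ∈ L → ¬ R u w

  Reach-stays : ∀ {X u v} → (∀ w → w ∈ X → S w) → u ∈ K → Reach R X u v → v ∈ K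
  Reach-stays X⊆S u∈K here = u∈K
  Reach-stays X⊆S u∈K (step {w = w} uRw w∈X w⇝v) with covers w (X⊆S w w∈X)
  ... | inj₁ w∈K = Reach-stays X⊆S w∈K w⇝v
  ... | inj₂ w∈L = ⊥-elim (no-edge u∈K w∈L uRw)

  Connected-meeting⇒⊆ : ∀ {X u} → (∀ w → w ∈ X → S w) → Connected R X → u ∈ X → u ∈ K → X ⊆ K
  Connected-meeting⇒⊆ X⊆S X-connected u∈X u∈K {v} v∈X =
    Reach-stays X⊆S u∈K (X-connected _ v u∈X v∈X)

  IsComponent-meeting⇒≡ : ∀ {X u} → IsComponent R S X → u ∈ X → u ∈ K → X ≡ K
  IsComponent-meeting⇒≡ (_ , X⊆S , X-connected , maximal) u∈X u∈K =
    sym (maximal K (Connected-meeting⇒⊆ X⊆S X-connected u∈X u∈K) part⊆S connected)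

  isComponent : Nonempty K → IsComponent R S K
  isComponent (u , u∈K) = (u , u∈K) , part⊆S , connected ,
    λ Y K⊆Y Y⊆S Y-connected → ⊆-antisym (Connected-meeting⇒⊆ Y⊆S Y-connected (K⊆Y u∈K) u∈K) K⊆Y

IsComponent-two-parts : ∀ {n R S} {K L X : Subset n} →
  SeparatedPart R S K L → SeparatedPart R S L K → IsComponent R S X → X ≡ K ⊎ X ≡ L
IsComponent-two-parts K-part L-part X-comp@((u , u∈X) , X⊆S , _) =
  Sum.map (IsComponent-meeting⇒≡ K-part X-comp u∈X) (IsComponent-meeting⇒≡ L-part X-comp u∈X)
    (covers K-part u (X⊆S u u∈X))
  where open SeparatedPart

module _ {n} (H : Graph n) where

  Adj-sym : ∀ {u v} → Adj H u v → Adj H v u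
  Adj-sym {u} {v} uv = trans (E-sym H v u) uv

  Adj-irrefl : ∀ {u v} → Adj H u v → u ≢ v
  Adj-irrefl {u} uu refl with trans (sym uu) (E-irr H u)
  ... | ()

  ∈N⇒Adj : ∀ {u v} → u ∈ N H v → Adj H v u
  ∈N⇒Adj {u} {v} u∈N = trans (sym (lookup∘tabulate (E H v) u)) ([]=⇒lookup u∈N)

  Adj⇒∈N : ∀ {u v} → Adj H v u → u ∈ N H v
  Adj⇒∈N {u} {v} vu = lookup⇒[]= u (N H v) (trans (lookup∘tabulate (E H v) u) vu)

  ∈N-⇒ : ∀ {u v w} → u ∈ N H v - w → Adj H v u × u ≢ w
  ∈N-⇒ u∈ = ∈N⇒Adj (p─q⊆p _ _ u∈) , x∉⁅y⁆⇒x≢y (x∈p─q⇒x∉q u∈)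

  ∈N-⇐ : ∀ {u v w} → Adj H v u → u ≢ w → u ∈ N H v - w
  ∈N-⇐ vu u≢w = x∈p∧x∉q⇒x∈p─q (Adj⇒∈N vu) (x≢y⇒x∉⁅y⁆ u≢w)

  ⊆N⇒Connected : ∀ {X v} → X ⊆ N H v → Connected (Adj² H) X
  ⊆N⇒Connected {v = v} X⊆N u w u∈X w∈X with u ≟ w
  ... | yes refl = here
  ... | no u≢w   = step (u≢w , inj₂ (v , Adj-sym (∈N⇒Adj (X⊆N u∈X)) , ∈N⇒Adj (X⊆N w∈X))) w∈X here

  GirthAtLeast-mono : ∀ {g h} → g ≤ h → GirthAtLeast h H → GirthAtLeast g H
  GirthAtLeast-mono g≤h girth m f f-cycle = ≤-trans g≤h (girth m f f-cycle)

  girth≤cycle : ∀ {g m} → GirthAtLeast g H → (vs : Vec (Fin n) (suc m)) → 2 ≤ m → Unique vs →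
    (∀ i → Adj H (lookup vs (inject₁ i)) (lookup vs (suc i))) →
    Adj H (lookup vs (fromℕ m)) (lookup vs zero) → g ≤ suc m
  girth≤cycle girth vs 2≤m distinct path closing =
    girth _ (lookup vs) (2≤m , (λ {i} {j} → lookup-injective distinct i j) , path , closing)

  no-triangle : GirthAtLeast 4 H → ∀ {a b c} → Adj H a b → Adj H b c → Adj H c a → ⊥
  no-triangle girth {a} {b} {c} ab bc ca = <-irrefl refl
    (girth≤cycle girth (a ∷ b ∷ c ∷ []) (s≤s (s≤s z≤n))
      ((Adj-irrefl ab ∷ ≢-sym (Adj-irrefl ca) ∷ []) ∷ (Adj-irrefl bc ∷ []) ∷ [] ∷ [])
      (λ { zero → ab ; (suc zero) → bc })
      ca)

  no-4-cycle : GirthAtLeast 5 H → ∀ {a b c d} → Adj H a b → Adj H b c → Adj H c d → Adj H d a →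
    a ≢ c → b ≢ d → ⊥
  no-4-cycle girth {a} {b} {c} {d} ab bc cd da a≢c b≢d = <-irrefl refl
    (girth≤cycle girth (a ∷ b ∷ c ∷ d ∷ []) (s≤s (s≤s z≤n))
      ((Adj-irrefl ab ∷ a≢c ∷ ≢-sym (Adj-irrefl da) ∷ []) ∷ (Adj-irrefl bc ∷ b≢d ∷ []) ∷
        (Adj-irrefl cd ∷ []) ∷ [] ∷ [])
      (λ { zero → ab ; (suc zero) → bc ; (suc (suc zero)) → cd })
      da)

  no-5-cycle : GirthAtLeast 6 H → ∀ {a b c d e} →
    Adj H a b → Adj H b c → Adj H c d → Adj H d e → Adj H e a →
    a ≢ c → a ≢ d → b ≢ d → b ≢ e → c ≢ e → ⊥
  no-5-cycle girth {a} {b} {c} {d} {e} ab bc cd de ea a≢c a≢d b≢d b≢e c≢e = <-irrefl refl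
    (girth≤cycle girth (a ∷ b ∷ c ∷ d ∷ e ∷ []) (s≤s (s≤s z≤n))
      ((Adj-irrefl ab ∷ a≢c ∷ a≢d ∷ ≢-sym (Adj-irrefl ea) ∷ []) ∷ (Adj-irrefl bc ∷ b≢d ∷ b≢e ∷ []) ∷
        (Adj-irrefl cd ∷ c≢e ∷ []) ∷ (Adj-irrefl de ∷ []) ∷ [] ∷ [])
      (λ { zero → ab ; (suc zero) → bc ; (suc (suc zero)) → cd ; (suc (suc (suc zero))) → de })
      ea)

  -- A repeated vertex splits a closed 5-walk into a closed 2-walk and a triangle.
  no-closed-5-walk : GirthAtLeast 6 H → ∀ {a b c d e} →
    Adj H a b → Adj H b c → Adj H c d → Adj H d e → Adj H e a → ⊥
  no-closed-5-walk girth {a} {b} {c} {d} {e} ab bc cd de ea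
    with GirthAtLeast-mono (m≤n+m 4 2) girth | a ≟ c | a ≟ d | b ≟ d | b ≟ e | c ≟ e
  ... | girth₄ | yes refl | _        | _        | _        | _        = no-triangle girth₄ cd de ea
  ... | girth₄ | no _     | yes refl | _        | _        | _        = no-triangle girth₄ ab bc cd
  ... | girth₄ | no _     | no _     | yes refl | _        | _        = no-triangle girth₄ de ea ab
  ... | girth₄ | no _     | no _     | no _     | yes refl | _        = no-triangle girth₄ bc cd de
  ... | girth₄ | no _     | no _     | no _     | no _     | yes refl = no-triangle girth₄ ea ab bc
  ... | _      | no a≢c   | no a≢d   | no b≢d   | no b≢e   | no c≢e   =
    no-5-cycle girth ab bc cd de ea a≢c a≢d b≢d b≢e c≢e

  ∈N-⇒C : ∀ {x y v} → Adj H x y → v ∈ N H x - y → C H x y v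
  ∈N-⇒C {x} xy v∈ with ∈N-⇒ v∈
  ... | xv , v≢y = (Adj-irrefl xv , inj₁ xv) , (≢-sym v≢y , inj₂ (x , Adj-sym xy , xv))

  C⇒∈N- : GirthAtLeast 6 H → ∀ {x y v} → Adj H x y → C H x y v → v ∈ N H x - y ⊎ v ∈ N H y - x
  C⇒∈N- girth xy ((_ , inj₁ xv) , (y≢v , _))     = inj₁ (∈N-⇐ xv (≢-sym y≢v))
  C⇒∈N- girth xy ((x≢v , inj₂ _) , (_ , inj₁ yv)) = inj₂ (∈N-⇐ yv (≢-sym x≢v))
  C⇒∈N- girth xy ((_ , inj₂ (a , xa , av)) , (_ , inj₂ (b , yb , bv))) =
    ⊥-elim (no-closed-5-walk girth xa av (Adj-sym bv) (Adj-sym yb) (Adj-sym xy))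

  N-∩N-≡∅ : GirthAtLeast 4 H → ∀ {x y} → Adj H x y → Disjoint (N H x - y) (N H y - x)
  N-∩N-≡∅ girth xy v v∈Nx v∈Ny =
    no-triangle girth xy (proj₁ (∈N-⇒ v∈Ny)) (Adj-sym (proj₁ (∈N-⇒ v∈Nx)))

  ¬Adj²-between-N- : GirthAtLeast 6 H → ∀ {x y u w} → Adj H x y →
    u ∈ N H x - y → w ∈ N H y - x → ¬ Adj² H u w
  ¬Adj²-between-N- girth xy u∈ w∈ uw² with ∈N-⇒ u∈ | ∈N-⇒ w∈ | uw²
  ... | xu , u≢y | yw , w≢x | _ , inj₁ uw =
    no-4-cycle (GirthAtLeast-mono (n≤1+n 5) girth)
      xu uw (Adj-sym yw) (Adj-sym xy) (≢-sym w≢x) u≢y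
  ... | xu , _ | yw , _ | _ , inj₂ (c , uc , cw) =
    no-closed-5-walk girth xu uc cw (Adj-sym yw) (Adj-sym xy)

  N-separatedPartˡ : GirthAtLeast 6 H → ∀ {x y} → Adj H x y →
    SeparatedPart (Adj² H) (C H x y) (N H x - y) (N H y - x)
  N-separatedPartˡ girth xy = record
    { part⊆S    = λ _ → ∈N-⇒C xy
    ; connected = ⊆N⇒Connected (p─q⊆p _ _)
    ; covers    = λ _ → C⇒∈N- girth xy
    ; no-edge   = ¬Adj²-between-N- girth xy
    }

  N-separatedPartʳ : GirthAtLeast 6 H → ∀ {x y} → Adj H x y →
    SeparatedPart (Adj² H) (C H x y) (N H y - x) (N H x - y)
  N-separatedPartʳ girth xy = record
    { part⊆S    = λ _ v∈ → swap (∈N-⇒C (Adj-sym xy) v∈)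
    ; connected = ⊆N⇒Connected (p─q⊆p _ _)
    ; covers    = λ _ v∈C → C⇒∈N- girth (Adj-sym xy) (swap v∈C)
    ; no-edge   = ¬Adj²-between-N- girth (Adj-sym xy)
    }

lemma3p3 : ∀ {n} (H : Graph n) → GirthAtLeast 6 H → (x y : Fin n) → Adj H x y →
    (∀ X Y Z → IsComponent (Adj² H) (C H x y) X → IsComponent (Adj² H) (C H x y) Y →
      IsComponent (Adj² H) (C H x y) Z → X ≡ Y ⊎ X ≡ Z ⊎ Y ≡ Z)
    × (∀ (A B : Subset n) → (∀ v → v ∈ A → v ∉ B) →
        (∀ X → IsComponent (Adj² H) (C H x y) X →
          (Nonempty A × X ≡ A) ⊎ (Nonempty B × X ≡ B)) →
        (Nonempty A → IsComponent (Adj² H) (C H x y) A) →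
        (Nonempty B → IsComponent (Adj² H) (C H x y) B) →
        (A ≡ N H x - y × B ≡ N H y - x) ⊎ (B ≡ N H x - y × A ≡ N H y - x))
lemma3p3 H girth x y xy =
  (λ X Y Z X-comp Y-comp Z-comp →
    ≡-two-of-three (component≡ X-comp) (component≡ Y-comp) (component≡ Z-comp)) ,
  λ A B A∩B≡∅ components A-comp B-comp →
    same-nonempty-members⇒≡ A∩B≡∅ (N-∩N-≡∅ H (GirthAtLeast-mono H (m≤n+m 4 2) girth) xy)
      (λ { X neX (inj₁ refl) → component≡ (A-comp neX)
         ; X neX (inj₂ refl) → component≡ (B-comp neX) })
      (λ { X neX (inj₁ refl) → Sum.map proj₂ proj₂ (components X (isComponent x-part neX))
         ; X neX (inj₂ refl) → Sum.map proj₂ proj₂ (components X (isComponent y-part neX)) })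
  where
  open SeparatedPart using (isComponent)

  x-part : SeparatedPart (Adj² H) (C H x y) (N H x - y) (N H y - x)
  x-part = N-separatedPartˡ H girth xy

  y-part : SeparatedPart (Adj² H) (C H x y) (N H y - x) (N H x - y)
  y-part = N-separatedPartʳ H girth xy

  component≡ : ∀ {X} → IsComponent (Adj² H) (C H x y) X → X ≡ N H x - y ⊎ X ≡ N H y - x
  component≡ = IsComponent-two-parts x-part y-part
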